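{- Let $N\geq 2$ be an integer. Then there exists a set $A\subseteq \mathbb{N}$ such that $R_2(A,n)=R_2(\mathbb{N}\setminus A,n)$ for all integers $n\geq 2N-1$, $|A\cap A_0|=+\infty$, $|A\cap B_0|=+\infty$, and $$R_2(A,n)\leq \frac{n+1}{4\cdot 2^{\lfloor \log _2(N-1) \rfloor }}$$ for infinitely many integers $n$.
   Context: $\mathbb{N}$ denotes the set of nonnegative integers (including $0$). For $A\subseteq\mathbb{N}$ and an integer $n$, $R_2(A,n)$ denotes the number of solutions of $n=a+a'$ with $a,a'\in A$ and $a<a'$. For $a\in\mathbb{N}$, $D(a)$ is the number of ones in the binary representation of $a$ (with $D(0)=0$). $A_0$ is the set of all $a\in\mathbb{N}$ with $D(a)$ even (the Thue–Morse set), and $B_0=\mathbb{N}\setminus A_0$. -}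

module Defs where

open import Data.Nat using (ℕ; zero; suc; _+_; _*_; _∸_; _<_; _<ᵇ_)
open import Data.Nat.DivMod using (_%_; _/_)
open import Data.Bool using (Bool; true; false; _∧_; if_then_else_; not)
open import Relation.Binary.PropositionalEquality using (_≡_)
open import Data.Product using (∃-syntax; _×_)
open import Data.Nat using (_≥_)

Subset : Set
Subset = ℕ → Bool

compl : Subset → Subset
compl A a = not (A a)

-- Number of ones in binary expansion, computed with fuel (fuel a suffices for a).
Dfuel : ℕ → ℕ → ℕ
Dfuel zero    a = 0
Dfuel (suc f) a = a % 2 + Dfuel f (a / 2)

D : ℕ → ℕ
D a = Dfuel a a

-- Thue–Morse set A₀ : D(a) even;  B₀ = ℕ \ A₀
inA₀ : ℕ → Set
inA₀ a = D a % 2 ≡ 0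

inB₀ : ℕ → Set
inB₀ a = D a % 2 ≡ 1

countBelow : (ℕ → Bool) → ℕ → ℕ
countBelow P zero    = 0
countBelow P (suc k) = (if P k then 1 else 0) + countBelow P k

-- R₂(A,n) = #{ (a,a') : a + a' = n, a < a', a,a' ∈ A }
--        = #{ a : a < n ∸ a (i.e. 2a < n), a ∈ A, n ∸ a ∈ A }, a ranges below n+1
R₂ : Subset → ℕ → ℕ
R₂ A n = countBelow (λ a → (a <ᵇ (n ∸ a)) ∧ A a ∧ A (n ∸ a)) (suc n)

Infinite : (ℕ → Set) → Set
Infinite P = ∀ m → ∃[ a ] (a ≥ m × P a)

{-# OPTIONS --safe #-}
-- Let L = 2 ^ k with k = ⌊log₂ (N − 1)⌋, and let χ be given by χ(0) = χ(1) = false, χ(2L) = true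
-- and otherwise χ(2c) = χ(c), χ(2c + 1) = ¬ χ(c): it agrees with the Thue–Morse set A₀ (minus 0)
-- except on the integers whose binary expansion begins with 1 0^(k+1), where it agrees with B₀.
--
-- Each pair {2c, 2c + 1} meets χ exactly once, except c = 0 (never) and c = L (twice), so
-- |χ ∩ [0, 2m + 1]| = m + 1 once m ≥ L.  For every A, counting the a < n − a gives
-- R₂(A, n) + ⌈n/2⌉ + [n even, n/2 ∈ A] = R₂(ℕ∖A, n) + |A ∩ [0, n]|, hence R₂(χ, n) = R₂(ℕ∖χ, n)
-- for n > 2L.  The elements 2^j (2L + 1) ∈ A₀ and 2^j 2L ∈ B₀ all lie in χ.
--
-- Let q i count the ordered representations of 2^i − 1 by χ.  Sorting the representations of
-- 2n + 1 by the parities of the summands relates them to those of n, up to corrections at the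
-- summands 0, L and their complements; for i ≥ k + 2 this gives q (i+1) + 2 q i = 2^i, hence
-- q (i+2) = 4 q i.  With q (k+2) = 2 for odd k, q (k+3) = 4 for even k ≥ 2 and q 3 = 2 for
-- k = 0, q i · 2L ≤ 2^i along an arithmetic progression of i, i.e. R₂(χ, 2^i − 1) ≤ 2^i / 4L.
module Submission where

open import Defs
open import Data.Nat using (ℕ; zero; suc; pred; _+_; _*_; _∸_; _^_; _≤_; _≥_; _<_; z≤n; s≤s; _<ᵇ_; _≡ᵇ_; ⌊_/2⌋; ⌈_/2⌉)
open import Data.Nat.Properties
open import Data.Nat.DivMod using (_%_; _/_; m*n/n≡m; m*n%n≡0; [m+kn]%n≡m%n; +-distrib-/; m/n<m)
open import Data.Nat.Logarithm using (⌊log₂_⌋; ⌊log₂⌊n/2⌋⌋≡⌊log₂n⌋∸1; ⌊log₂⌋-mono-≤; ⌊log₂[2^n]⌋≡n)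
open import Data.Nat.Tactic.RingSolver using (solve-∀)
open import Data.Nat.Induction using (<-rec)
open import Data.Bool using (Bool; true; false; _∧_; _xor_; not; if_then_else_; T)
open import Data.Bool.Properties using (∧-identityʳ; ∧-zeroʳ; ∧-comm; not-involutive; not-distribˡ-xor; not-distribʳ-xor; xor-identityʳ)
open import Data.Empty using (⊥-elim)
open import Data.Product using (∃-syntax; _×_; _,_)
open import Data.Sum using (_⊎_; inj₁; inj₂)
open import Function using (_∘_; const)
open import Relation.Binary.PropositionalEquality
open import Relation.Nullary using (¬_; yes; no)
open import Relation.Binary using (tri<; tri≈; tri>)

≡ᵇ-refl : ∀ m → (m ≡ᵇ m) ≡ true
≡ᵇ-refl zero    = refl
≡ᵇ-refl (suc m) = ≡ᵇ-refl m

≢⇒≡ᵇ-false : ∀ {m n} → m ≢ n → (m ≡ᵇ n) ≡ false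
≢⇒≡ᵇ-false {m} {n} m≢n with m ≡ᵇ n in eq
... | true  = ⊥-elim (m≢n (≡ᵇ⇒≡ m n (subst T (sym eq) _)))
... | false = refl

<⇒<ᵇ-true : ∀ {m n} → m < n → (m <ᵇ n) ≡ true
<⇒<ᵇ-true {m} {n} m<n with m <ᵇ n in eq
... | true  = refl
... | false = ⊥-elim (subst T eq (<⇒<ᵇ m<n))

≮⇒<ᵇ-false : ∀ {m n} → ¬ (m < n) → (m <ᵇ n) ≡ false
≮⇒<ᵇ-false {m} {n} m≮n with m <ᵇ n in eq
... | true  = ⊥-elim (m≮n (<ᵇ⇒< m n (subst T (sym eq) _)))
... | false = refl

infinite-via : ∀ {P : ℕ → Set} (f : ℕ → ℕ) → (∀ j → j ≤ f j) → (∀ j → P (f j)) → Infinite P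
infinite-via f j≤f P∘f m = f m , j≤f m , P∘f m

-- Binary expansions

2*n≡n+n : ∀ n → 2 * n ≡ n + n
2*n≡n+n n = cong (n +_) (+-identityʳ n)

[2*n]%2≡0 : ∀ n → (2 * n) % 2 ≡ 0
[2*n]%2≡0 n = trans (cong (_% 2) (*-comm 2 n)) (m*n%n≡0 n 2)

[2*n]/2≡n : ∀ n → (2 * n) / 2 ≡ n
[2*n]/2≡n n = trans (cong (_/ 2) (*-comm 2 n)) (m*n/n≡m n 2)

[1+2*n]%2≡1 : ∀ n → (1 + 2 * n) % 2 ≡ 1
[1+2*n]%2≡1 n = trans (cong (λ x → (1 + x) % 2) (*-comm 2 n)) ([m+kn]%n≡m%n 1 n 2)

[1+2*n]/2≡n : ∀ n → (1 + 2 * n) / 2 ≡ n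
[1+2*n]/2≡n n = trans (cong (λ x → (1 + x) / 2) (*-comm 2 n))
  (trans (+-distrib-/ 1 (n * 2) (subst (λ x → 1 + x < 2) (sym (m*n%n≡0 n 2)) ≤-refl)) (m*n/n≡m n 2))

1+2*m≢2*n : ∀ m n → 1 + 2 * m ≢ 2 * n
1+2*m≢2*n m n eq = 1≢0 (trans (sym ([1+2*n]%2≡1 m)) (trans (cong (_% 2) eq) ([2*n]%2≡0 n)))
  where
  1≢0 : 1 ≢ 0
  1≢0 ()

n/2<n : ∀ n → 2 ≤ n → n / 2 < n
n/2<n n@(suc (suc _)) _ = m/n<m n 2 (s≤s (s≤s z≤n))
n/2<n (suc zero) (s≤s ())

n≢0⇒2≤2*n : ∀ {n} → n ≢ 0 → 2 ≤ 2 * n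
n≢0⇒2≤2*n {zero}  n≢0 = ⊥-elim (n≢0 refl)
n≢0⇒2≤2*n {suc n} _   = *-monoʳ-≤ 2 (s≤s (z≤n {n}))

Dfuel-0 : ∀ f → Dfuel f 0 ≡ 0
Dfuel-0 zero    = refl
Dfuel-0 (suc f) = Dfuel-0 f

Dfuel-enough : ∀ f g a → a ≤ f → a ≤ g → Dfuel f a ≡ Dfuel g a
Dfuel-enough f g zero _ _ = trans (Dfuel-0 f) (sym (Dfuel-0 g))
Dfuel-enough (suc f) (suc g) (suc zero) _ _ = cong suc (trans (Dfuel-0 f) (sym (Dfuel-0 g)))
Dfuel-enough (suc f) (suc g) a@(suc (suc _)) (s≤s a≤f) (s≤s a≤g) =
  cong (a % 2 +_) (Dfuel-enough f g (a / 2) (≤-trans a/2≤ a≤f) (≤-trans a/2≤ a≤g))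
  where
  a/2≤ : a / 2 ≤ pred a
  a/2≤ = ≤-pred (n/2<n a (s≤s (s≤s z≤n)))

D-unfold : ∀ a → 2 ≤ a → D a ≡ a % 2 + D (a / 2)
D-unfold a@(suc f) 2≤a = cong (a % 2 +_) (Dfuel-enough f (a / 2) (a / 2) (≤-pred (n/2<n a 2≤a)) ≤-refl)

D-double : ∀ n → D (2 * n) ≡ D n
D-double zero = refl
D-double n@(suc _) =
  trans (D-unfold (2 * n) (n≢0⇒2≤2*n {n} λ ())) (cong₂ _+_ ([2*n]%2≡0 n) (cong D ([2*n]/2≡n n)))

D-1+double : ∀ n → n ≢ 0 → D (1 + 2 * n) ≡ 1 + D n
D-1+double n n≢0 = trans (D-unfold (1 + 2 * n) (≤-trans (n≢0⇒2≤2*n n≢0) (n≤1+n _)))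
  (cong₂ _+_ ([1+2*n]%2≡1 n) (cong D ([1+2*n]/2≡n n)))

D-2^ : ∀ k → D (2 ^ k) ≡ 1
D-2^ zero    = refl
D-2^ (suc k) = trans (D-double (2 ^ k)) (D-2^ k)

doubled : ℕ → ℕ → ℕ
doubled zero    y = y
doubled (suc j) y = 2 * doubled j y

D-doubled : ∀ j y → D (doubled j y) ≡ D y
D-doubled zero    y = refl
D-doubled (suc j) y = trans (D-double (doubled j y)) (D-doubled j y)

y≤doubled : ∀ j y → y ≤ doubled j y
y≤doubled zero    y = ≤-refl
y≤doubled (suc j) y = ≤-trans (y≤doubled j y) (m≤m+n _ _)

j<doubled : ∀ j y → 1 ≤ y → j < doubled j y
j<doubled zero    y 1≤y = 1≤y
j<doubled (suc j) y 1≤y = <-≤-trans (s≤s (j<doubled j y 1≤y)) 1+d≤2*d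
  where
  d : ℕ
  d = doubled j y
  1+d≤2*d : 1 + d ≤ 2 * d
  1+d≤2*d = subst (1 + d ≤_) (sym (2*n≡n+n d)) (+-monoˡ-≤ d (≤-trans 1≤y (y≤doubled j y)))

ones : ℕ → ℕ
ones zero    = 0
ones (suc i) = 1 + 2 * ones i

suc-ones : ∀ i → suc (ones i) ≡ 2 ^ i
suc-ones zero    = refl
suc-ones (suc i) = trans (sym (*-suc 2 (ones i))) (cong (2 *_) (suc-ones i))

i≤ones : ∀ i → i ≤ ones i
i≤ones zero    = z≤n
i≤ones (suc i) = s≤s (≤-trans (i≤ones i) (m≤m+n (ones i) _))

appendOnes : ℕ → ℕ → ℕ
appendOnes zero    c = c
appendOnes (suc s) c = 1 + 2 * appendOnes s c

appendOnes-ones : ∀ s t → appendOnes s (ones t) ≡ ones (s + t)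
appendOnes-ones zero    t = refl
appendOnes-ones (suc s) t = cong (λ x → 1 + 2 * x) (appendOnes-ones s t)

appendOnes-suc : ∀ s c → appendOnes s (suc c) ≡ appendOnes s c + 2 ^ s
appendOnes-suc zero    c = +-comm 1 c
appendOnes-suc (suc s) c = trans (cong (λ x → 1 + 2 * x) (appendOnes-suc s c)) (distrib (appendOnes s c) (2 ^ s))
  where
  distrib : ∀ a b → 1 + 2 * (a + b) ≡ 1 + 2 * a + 2 * b
  distrib = solve-∀

appendOnes-≢0 : ∀ s c → c ≢ 0 → appendOnes s c ≢ 0
appendOnes-≢0 zero    c c≢0 = c≢0
appendOnes-≢0 (suc s) c _   ()

twice : ℕ → ℕ
twice zero    = zero
twice (suc r) = suc (suc (twice r))

r≤twice : ∀ r → r ≤ twice r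
r≤twice zero    = z≤n
r≤twice (suc r) = s≤s (≤-trans (r≤twice r) (n≤1+n _))

odd : ℕ → Bool
odd zero    = false
odd (suc j) = not (odd j)

odd-twice : ∀ r → odd (twice r) ≡ false
odd-twice zero    = refl
odd-twice (suc r) = trans (not-involutive _) (odd-twice r)

zero-or-odd-or-even : ∀ k → k ≡ 0 ⊎ ∃[ r ] k ≡ suc (twice r) ⊎ ∃[ r ] k ≡ twice (suc r)
zero-or-odd-or-even zero = inj₁ refl
zero-or-odd-or-even (suc k) with zero-or-odd-or-even k
... | inj₁ refl               = inj₂ (inj₁ (0 , refl))
... | inj₂ (inj₁ (r , refl)) = inj₂ (inj₂ (r , refl))
... | inj₂ (inj₂ (r , refl)) = inj₂ (inj₁ (suc r , refl))

even-or-odd : ∀ n → ∃[ m ] (n ≡ 2 * m ⊎ n ≡ 1 + 2 * m)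
even-or-odd zero = 0 , inj₁ refl
even-or-odd (suc n) with even-or-odd n
... | m , inj₁ n≡2m   = m , inj₂ (cong suc n≡2m)
... | m , inj₂ n≡1+2m = suc m , inj₁ (trans (cong suc n≡1+2m) (sym (*-suc 2 m)))

2^⌊log₂n⌋≤n : ∀ n → 1 ≤ n → 2 ^ ⌊log₂ n ⌋ ≤ n
2^⌊log₂n⌋≤n = <-rec (λ n → 1 ≤ n → 2 ^ ⌊log₂ n ⌋ ≤ n) step
  where
  step : ∀ n → (∀ {m} → m < n → 1 ≤ m → 2 ^ ⌊log₂ m ⌋ ≤ m) → 1 ≤ n → 2 ^ ⌊log₂ n ⌋ ≤ n
  step (suc zero)      _  _ = ≤-refl
  step n@(suc (suc m)) ih _ = begin
    2 ^ ⌊log₂ n ⌋               ≡⟨ cong (2 ^_) log-halves ⟩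
    2 * 2 ^ ⌊log₂ ⌊ n /2⌋ ⌋      ≤⟨ *-monoʳ-≤ 2 (ih (⌊n/2⌋<n (suc m)) (s≤s z≤n)) ⟩
    2 * ⌊ n /2⌋                  ≡⟨ 2*n≡n+n ⌊ n /2⌋ ⟩
    ⌊ n /2⌋ + ⌊ n /2⌋            ≤⟨ +-monoʳ-≤ ⌊ n /2⌋ (⌊n/2⌋≤⌈n/2⌉ n) ⟩
    ⌊ n /2⌋ + ⌈ n /2⌉            ≡⟨ ⌊n/2⌋+⌈n/2⌉≡n n ⟩
    n                            ∎
    where
    open ≤-Reasoning
    1≤log : 1 ≤ ⌊log₂ n ⌋
    1≤log = subst (_≤ ⌊log₂ n ⌋) (⌊log₂[2^n]⌋≡n 1) (⌊log₂⌋-mono-≤ {2} {n} (s≤s (s≤s z≤n)))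
    log-halves : ⌊log₂ n ⌋ ≡ suc ⌊log₂ ⌊ n /2⌋ ⌋
    log-halves = trans (sym (m+[n∸m]≡n 1≤log)) (cong suc (sym (⌊log₂⌊n/2⌋⌋≡⌊log₂n⌋∸1 n)))

-- Finite sums

⟦_⟧ : Bool → ℕ
⟦ b ⟧ = if b then 1 else 0

⟦not⟧+⟦⟧ : ∀ b → ⟦ not b ⟧ + ⟦ b ⟧ ≡ 1
⟦not⟧+⟦⟧ true  = refl
⟦not⟧+⟦⟧ false = refl

⟦⟧-exactly-one : ∀ x y → ⟦ x ∧ not y ⟧ + ⟦ not x ∧ y ⟧ ≡ ⟦ x xor y ⟧
⟦⟧-exactly-one true  true  = refl
⟦⟧-exactly-one true  false = refl
⟦⟧-exactly-one false true  = refl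
⟦⟧-exactly-one false false = refl

∑< : ℕ → (ℕ → ℕ) → ℕ
∑< zero    f = 0
∑< (suc k) f = f k + ∑< k f

syntax ∑< k (λ a → e) = ∑[ a < k ] e

countBelow≡∑ : ∀ P k → countBelow P k ≡ ∑[ a < k ] ⟦ P a ⟧
countBelow≡∑ P zero    = refl
countBelow≡∑ P (suc k) = cong (⟦ P k ⟧ +_) (countBelow≡∑ P k)

∑-cong : ∀ {f g} k → (∀ a → a < k → f a ≡ g a) → ∑< k f ≡ ∑< k g
∑-cong zero    _   = refl
∑-cong (suc k) f≗g = cong₂ _+_ (f≗g k ≤-refl) (∑-cong k (λ a a<k → f≗g a (m≤n⇒m≤1+n a<k)))

∑-+ : ∀ f g k → ∑[ a < k ] (f a + g a) ≡ ∑< k f + ∑< k g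
∑-+ f g zero    = refl
∑-+ f g (suc k) = trans (cong (f k + g k +_) (∑-+ f g k)) (+-+-comm (f k) (g k) _ _)
  where
  +-+-comm : ∀ a b c d → (a + b) + (c + d) ≡ (a + c) + (b + d)
  +-+-comm = solve-∀

∑-const : ∀ k v → ∑[ _ < k ] v ≡ k * v
∑-const zero    v = refl
∑-const (suc k) v = cong (v +_) (∑-const k v)

∑-shift : ∀ f k → ∑< (suc k) f ≡ f 0 + ∑[ a < k ] f (suc a)
∑-shift f zero    = refl
∑-shift f (suc k) = trans (cong (f (suc k) +_) (∑-shift f k)) (+-comm-middle (f (suc k)) (f 0) _)
  where
  +-comm-middle : ∀ a b c → a + (b + c) ≡ b + (a + c)
  +-comm-middle = solve-∀

∑-reverse : ∀ f n → ∑[ a < suc n ] f (n ∸ a) ≡ ∑< (suc n) f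
∑-reverse f zero    = refl
∑-reverse f (suc n) = trans (∑-shift (λ a → f (suc n ∸ a)) (suc n)) (cong (f (suc n) +_) (∑-reverse f n))

∑-reverse-pairs : ∀ (F : ℕ → ℕ → ℕ) n → ∑[ a < suc n ] F a (n ∸ a) ≡ ∑[ a < suc n ] F (n ∸ a) a
∑-reverse-pairs F n = trans (sym (∑-reverse (λ b → F b (n ∸ b)) n))
  (∑-cong (suc n) (λ a a≤n → cong (F (n ∸ a)) (m∸[m∸n]≡n (≤-pred a≤n))))

∑-pairs : ∀ f m → ∑< (2 * m) f ≡ ∑[ c < m ] (f (2 * c) + f (1 + 2 * c))
∑-pairs f zero    = refl
∑-pairs f (suc m) = trans (cong (λ k → ∑< k f) (*-suc 2 m))
  (trans (cong (λ s → f (1 + 2 * m) + (f (2 * m) + s)) (∑-pairs f m)) (reassoc (f (1 + 2 * m)) (f (2 * m)) _))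
  where
  reassoc : ∀ a b c → a + (b + c) ≡ (b + a) + c
  reassoc = solve-∀

∑-zero : ∀ f k → (∀ a → a < k → f a ≡ 0) → ∑< k f ≡ 0
∑-zero f zero    _    = refl
∑-zero f (suc k) f≗0 = cong₂ _+_ (f≗0 k ≤-refl) (∑-zero f k (λ a a<k → f≗0 a (m≤n⇒m≤1+n a<k)))

∑-single : ∀ f d k → d < k → (∀ a → a < k → a ≢ d → f a ≡ 0) → ∑< k f ≡ f d
∑-single f d (suc k) d<1+k f≗0 with k ≟ d
... | yes refl = trans (cong (f k +_) (∑-zero f k (λ a a<k → f≗0 a (m≤n⇒m≤1+n a<k) (<⇒≢ a<k))))
                       (+-identityʳ (f k))
... | no k≢d   = cong₂ _+_ (f≗0 k ≤-refl k≢d)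
                   (∑-single f d k (≤∧≢⇒< (≤-pred d<1+k) (k≢d ∘ sym)) (λ a a<k → f≗0 a (m≤n⇒m≤1+n a<k)))

δ : ℕ → ℕ → ℕ → ℕ
δ d v c = if c ≡ᵇ d then v else 0

δ-at : ∀ d v → δ d v d ≡ v
δ-at d v rewrite ≡ᵇ-refl d = refl

δ-off : ∀ {d c} v → c ≢ d → δ d v c ≡ 0
δ-off v c≢d rewrite ≢⇒≡ᵇ-false c≢d = refl

∑-δ : ∀ d v k → d < k → ∑< k (δ d v) ≡ v
∑-δ d v k d<k = trans (∑-single (δ d v) d k d<k (λ _ _ → δ-off v)) (δ-at d v)

-- Representation counts

count : Subset → ℕ → ℕ
count A n = ∑[ a < suc n ] ⟦ A a ⟧

lowerHalf : ℕ → (ℕ → Bool) → ℕ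
lowerHalf n h = ∑[ a < suc n ] ⟦ (a <ᵇ n ∸ a) ∧ h a ⟧

middle : ℕ → (ℕ → Bool) → ℕ
middle n h = ∑[ a < suc n ] ⟦ (a ≡ᵇ n ∸ a) ∧ h a ⟧

⟦⟧-trichotomy : ∀ a b h → ⟦ h ⟧ ≡ ⟦ (a <ᵇ b) ∧ h ⟧ + ⟦ (b <ᵇ a) ∧ h ⟧ + ⟦ (a ≡ᵇ b) ∧ h ⟧
⟦⟧-trichotomy a b false rewrite ∧-zeroʳ (a <ᵇ b) | ∧-zeroʳ (b <ᵇ a) | ∧-zeroʳ (a ≡ᵇ b) = refl
⟦⟧-trichotomy a b true  rewrite ∧-identityʳ (a <ᵇ b) | ∧-identityʳ (b <ᵇ a) | ∧-identityʳ (a ≡ᵇ b)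
  with <-cmp a b
... | tri< a<b _ _ rewrite <⇒<ᵇ-true a<b | ≮⇒<ᵇ-false (<⇒≯ a<b) | ≢⇒≡ᵇ-false (<⇒≢ a<b) = refl
... | tri≈ _ refl _ rewrite ≮⇒<ᵇ-false (<-irrefl {a} refl) | ≡ᵇ-refl a = refl
... | tri> _ _ b<a rewrite <⇒<ᵇ-true b<a | ≮⇒<ᵇ-false (<⇒≯ b<a) | ≢⇒≡ᵇ-false (<⇒≢ b<a ∘ sym) = refl

∑-halves : ∀ n h → ∑[ a < suc n ] ⟦ h a ⟧ ≡ lowerHalf n h + lowerHalf n (h ∘ (n ∸_)) + middle n h
∑-halves n h = begin
  ∑[ a < suc n ] ⟦ h a ⟧
    ≡⟨ ∑-cong (suc n) (λ a _ → ⟦⟧-trichotomy a (n ∸ a) (h a)) ⟩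
  ∑[ a < suc n ] (⟦ (a <ᵇ n ∸ a) ∧ h a ⟧ + ⟦ (n ∸ a <ᵇ a) ∧ h a ⟧ + ⟦ (a ≡ᵇ n ∸ a) ∧ h a ⟧)
    ≡⟨ ∑-+ (λ a → ⟦ (a <ᵇ n ∸ a) ∧ h a ⟧ + ⟦ (n ∸ a <ᵇ a) ∧ h a ⟧)
           (λ a → ⟦ (a ≡ᵇ n ∸ a) ∧ h a ⟧) (suc n) ⟩
  ∑[ a < suc n ] (⟦ (a <ᵇ n ∸ a) ∧ h a ⟧ + ⟦ (n ∸ a <ᵇ a) ∧ h a ⟧) + middle n h
    ≡⟨ cong (_+ middle n h)
            (∑-+ (λ a → ⟦ (a <ᵇ n ∸ a) ∧ h a ⟧) (λ a → ⟦ (n ∸ a <ᵇ a) ∧ h a ⟧) (suc n)) ⟩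
  lowerHalf n h + ∑[ a < suc n ] ⟦ (n ∸ a <ᵇ a) ∧ h a ⟧ + middle n h
    ≡⟨ cong (λ s → lowerHalf n h + s + middle n h) (∑-reverse-pairs (λ a b → ⟦ (b <ᵇ a) ∧ h a ⟧) n) ⟩
  lowerHalf n h + lowerHalf n (h ∘ (n ∸_)) + middle n h ∎
  where open ≡-Reasoning

1+2*m∸a≢a : ∀ m a → a ≤ 1 + 2 * m → a ≢ (1 + 2 * m) ∸ a
1+2*m∸a≢a m a a≤n a≡n∸a = 1+2*m≢2*n m a (begin
  1 + 2 * m          ≡⟨ m+[n∸m]≡n a≤n ⟨
  a + (1 + 2 * m ∸ a) ≡⟨ cong (a +_) a≡n∸a ⟨
  a + a              ≡⟨ 2*n≡n+n a ⟨
  2 * a              ∎)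
  where open ≡-Reasoning

2*m∸a≡a⇒a≡m : ∀ m a → a ≤ 2 * m → a ≡ 2 * m ∸ a → a ≡ m
2*m∸a≡a⇒a≡m m a a≤n a≡n∸a = *-cancelˡ-≡ a m 2 (begin
  2 * a              ≡⟨ 2*n≡n+n a ⟩
  a + a              ≡⟨ cong (a +_) a≡n∸a ⟩
  a + (2 * m ∸ a)    ≡⟨ m+[n∸m]≡n a≤n ⟩
  2 * m              ∎)
  where open ≡-Reasoning

middle-odd : ∀ m h → middle (1 + 2 * m) h ≡ 0
middle-odd m h = ∑-zero _ (suc (1 + 2 * m))
  (λ a a≤n → cong (λ b → ⟦ b ∧ h a ⟧) (≢⇒≡ᵇ-false (1+2*m∸a≢a m a (≤-pred a≤n))))

middle-even : ∀ m h → middle (2 * m) h ≡ ⟦ h m ⟧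
middle-even m h = trans (∑-single _ m (suc (2 * m)) (s≤s m≤2m) off) at-m
  where
  m≤2m : m ≤ 2 * m
  m≤2m = subst (m ≤_) (sym (2*n≡n+n m)) (m≤m+n m m)
  off : ∀ a → a < suc (2 * m) → a ≢ m → ⟦ (a ≡ᵇ 2 * m ∸ a) ∧ h a ⟧ ≡ 0
  off a a≤n a≢m = cong (λ b → ⟦ b ∧ h a ⟧) (≢⇒≡ᵇ-false (a≢m ∘ 2*m∸a≡a⇒a≡m m a (≤-pred a≤n)))
  at-m : ⟦ (m ≡ᵇ 2 * m ∸ m) ∧ h m ⟧ ≡ ⟦ h m ⟧
  at-m rewrite 2*n≡n+n m | m+n∸m≡n m m | ≡ᵇ-refl m = refl

lowerHalf-true : ∀ n → suc n ≡ lowerHalf n (const true) + lowerHalf n (const true) + middle n (const true)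
lowerHalf-true n = trans (sym (trans (∑-const (suc n) 1) (*-identityʳ (suc n)))) (∑-halves n (const true))

lowerHalf-true-odd : ∀ m → lowerHalf (1 + 2 * m) (const true) ≡ suc m
lowerHalf-true-odd m = *-cancelˡ-≡ _ _ 2 (begin
  2 * t          ≡⟨ 2*n≡n+n t ⟩
  t + t          ≡⟨ +-identityʳ (t + t) ⟨
  t + t + 0      ≡⟨ cong (t + t +_) (middle-odd m (const true)) ⟨
  t + t + middle n (const true)   ≡⟨ lowerHalf-true n ⟨
  suc n          ≡⟨ *-suc 2 m ⟨
  2 * suc m      ∎)
  where
  n : ℕ
  n = 1 + 2 * m
  t : ℕ
  t = lowerHalf n (const true)
  open ≡-Reasoning

lowerHalf-true-even : ∀ m → lowerHalf (2 * m) (const true) ≡ m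
lowerHalf-true-even m = *-cancelˡ-≡ _ _ 2 (suc-injective (begin
  suc (2 * t)    ≡⟨ cong suc (2*n≡n+n t) ⟩
  suc (t + t)    ≡⟨ +-comm 1 (t + t) ⟩
  t + t + 1      ≡⟨ cong (t + t +_) (middle-even m (const true)) ⟨
  t + t + middle n (const true)   ≡⟨ lowerHalf-true n ⟨
  suc (2 * m)    ∎))
  where
  n : ℕ
  n = 2 * m
  t : ℕ
  t = lowerHalf n (const true)
  open ≡-Reasoning

R₂≡lowerHalf : ∀ A n → R₂ A n ≡ lowerHalf n (λ a → A a ∧ A (n ∸ a))
R₂≡lowerHalf A n = countBelow≡∑ _ (suc n)

⟦⟧-both-or-neither : ∀ l x y →
  ⟦ l ∧ x ∧ y ⟧ + ⟦ l ∧ true ⟧ ≡ ⟦ l ∧ not x ∧ not y ⟧ + (⟦ l ∧ x ⟧ + ⟦ l ∧ y ⟧)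
⟦⟧-both-or-neither false _     _     = refl
⟦⟧-both-or-neither true  true  true  = refl
⟦⟧-both-or-neither true  true  false = refl
⟦⟧-both-or-neither true  false true  = refl
⟦⟧-both-or-neither true  false false = refl

R₂-compl-balance : ∀ A n → R₂ A n + lowerHalf n (const true) + middle n A ≡ R₂ (compl A) n + count A n
R₂-compl-balance A n = begin
  R₂ A n + lowerHalf n (const true) + middle n A
    ≡⟨ cong (λ r → r + lowerHalf n (const true) + middle n A) (R₂≡lowerHalf A n) ⟩
  ∑[ a < suc n ] ⟦ l a ∧ A a ∧ A (n ∸ a) ⟧ + ∑[ a < suc n ] ⟦ l a ∧ true ⟧ + middle n A
    ≡⟨ cong (_+ middle n A) (sym (∑-+ (λ a → ⟦ l a ∧ A a ∧ A (n ∸ a) ⟧) (λ a → ⟦ l a ∧ true ⟧) (suc n))) ⟩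
  ∑[ a < suc n ] (⟦ l a ∧ A a ∧ A (n ∸ a) ⟧ + ⟦ l a ∧ true ⟧) + middle n A
    ≡⟨ cong (_+ middle n A) (∑-cong (suc n) (λ a _ → ⟦⟧-both-or-neither (l a) (A a) (A (n ∸ a)))) ⟩
  ∑[ a < suc n ] (⟦ l a ∧ not (A a) ∧ not (A (n ∸ a)) ⟧ + (⟦ l a ∧ A a ⟧ + ⟦ l a ∧ A (n ∸ a) ⟧)) + middle n A
    ≡⟨ cong (_+ middle n A) (∑-+ (λ a → ⟦ l a ∧ not (A a) ∧ not (A (n ∸ a)) ⟧)
                                 (λ a → ⟦ l a ∧ A a ⟧ + ⟦ l a ∧ A (n ∸ a) ⟧) (suc n)) ⟩
  ∑[ a < suc n ] ⟦ l a ∧ not (A a) ∧ not (A (n ∸ a)) ⟧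
    + ∑[ a < suc n ] (⟦ l a ∧ A a ⟧ + ⟦ l a ∧ A (n ∸ a) ⟧) + middle n A
    ≡⟨ cong₂ (λ r s → r + s + middle n A) (sym (R₂≡lowerHalf (compl A) n))
             (∑-+ (λ a → ⟦ l a ∧ A a ⟧) (λ a → ⟦ l a ∧ A (n ∸ a) ⟧) (suc n)) ⟩
  R₂ (compl A) n + (lowerHalf n A + lowerHalf n (A ∘ (n ∸_))) + middle n A
    ≡⟨ +-assoc (R₂ (compl A) n) _ (middle n A) ⟩
  R₂ (compl A) n + (lowerHalf n A + lowerHalf n (A ∘ (n ∸_)) + middle n A)
    ≡⟨ cong (R₂ (compl A) n +_) (∑-halves n A) ⟨
  R₂ (compl A) n + count A n ∎
  where
  open ≡-Reasoning
  l : ℕ → Bool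
  l a = a <ᵇ n ∸ a

R₂-compl-odd : ∀ A m → count A (1 + 2 * m) ≡ suc m → R₂ A (1 + 2 * m) ≡ R₂ (compl A) (1 + 2 * m)
R₂-compl-odd A m count≡ = +-cancelʳ-≡ (suc m) _ _ (begin
  R₂ A n + suc m                                       ≡⟨ +-identityʳ _ ⟨
  R₂ A n + suc m + 0
    ≡⟨ cong₂ (λ h t → R₂ A n + h + t) (lowerHalf-true-odd m) (middle-odd m A) ⟨
  R₂ A n + lowerHalf n (const true) + middle n A       ≡⟨ R₂-compl-balance A n ⟩
  R₂ (compl A) n + count A n                           ≡⟨ cong (R₂ (compl A) n +_) count≡ ⟩
  R₂ (compl A) n + suc m                               ∎)
  where
  n : ℕ
  n = 1 + 2 * m
  open ≡-Reasoning

R₂-compl-even : ∀ A m → count A (2 * m) ≡ m + ⟦ A m ⟧ → R₂ A (2 * m) ≡ R₂ (compl A) (2 * m)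
R₂-compl-even A m count≡ = +-cancelʳ-≡ (m + ⟦ A m ⟧) _ _ (begin
  R₂ A n + (m + ⟦ A m ⟧)                               ≡⟨ +-assoc (R₂ A n) m ⟦ A m ⟧ ⟨
  R₂ A n + m + ⟦ A m ⟧
    ≡⟨ cong₂ (λ h t → R₂ A n + h + t) (lowerHalf-true-even m) (middle-even m A) ⟨
  R₂ A n + lowerHalf n (const true) + middle n A       ≡⟨ R₂-compl-balance A n ⟩
  R₂ (compl A) n + count A n                           ≡⟨ cong (R₂ (compl A) n +_) count≡ ⟩
  R₂ (compl A) n + (m + ⟦ A m ⟧)                       ∎)
  where
  n : ℕ
  n = 2 * m
  open ≡-Reasoning

orderedR₂ : Subset → ℕ → ℕ
orderedR₂ A n = ∑[ a < suc n ] ⟦ A a ∧ A (n ∸ a) ⟧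

orderedR₂-odd : ∀ A m → orderedR₂ A (1 + 2 * m) ≡ 2 * R₂ A (1 + 2 * m)
orderedR₂-odd A m = begin
  orderedR₂ A n                              ≡⟨ ∑-halves n h ⟩
  lowerHalf n h + lowerHalf n (h ∘ (n ∸_)) + middle n h
    ≡⟨ cong₂ (λ r t → lowerHalf n h + r + t) (∑-cong (suc n) swap) (middle-odd m h) ⟩
  lowerHalf n h + lowerHalf n h + 0          ≡⟨ +-identityʳ _ ⟩
  lowerHalf n h + lowerHalf n h              ≡⟨ cong (λ r → r + r) (R₂≡lowerHalf A n) ⟨
  R₂ A n + R₂ A n                            ≡⟨ 2*n≡n+n (R₂ A n) ⟨
  2 * R₂ A n                                 ∎
  where
  open ≡-Reasoning
  n : ℕ
  n = 1 + 2 * m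
  h : ℕ → Bool
  h a = A a ∧ A (n ∸ a)
  swap : ∀ a → a < suc n → ⟦ (a <ᵇ n ∸ a) ∧ h (n ∸ a) ⟧ ≡ ⟦ (a <ᵇ n ∸ a) ∧ h a ⟧
  swap a a≤n = trans (cong (λ b → ⟦ (a <ᵇ n ∸ a) ∧ A (n ∸ a) ∧ A b ⟧) (m∸[m∸n]≡n (≤-pred a≤n)))
                     (cong (λ b → ⟦ (a <ᵇ n ∸ a) ∧ b ⟧) (∧-comm (A (n ∸ a)) (A a)))

⟦⟧-xor-∧ : ∀ x y → ⟦ x xor y ⟧ + (⟦ x ∧ y ⟧ + ⟦ x ∧ y ⟧) ≡ ⟦ x ⟧ + ⟦ y ⟧
⟦⟧-xor-∧ true  true  = refl
⟦⟧-xor-∧ true  false = refl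
⟦⟧-xor-∧ false true  = refl
⟦⟧-xor-∧ false false = refl

mixed : Subset → ℕ → ℕ
mixed A n = ∑[ c < suc n ] ⟦ A c xor A (n ∸ c) ⟧

mixed+orderedR₂ : ∀ A n → mixed A n + 2 * orderedR₂ A n ≡ 2 * count A n
mixed+orderedR₂ A n = begin
  mixed A n + 2 * orderedR₂ A n
    ≡⟨ cong (mixed A n +_) (trans (2*n≡n+n (orderedR₂ A n)) (sym (∑-+ both both (suc n)))) ⟩
  mixed A n + ∑[ c < suc n ] (both c + both c)
    ≡⟨ ∑-+ (λ c → ⟦ A c xor A (n ∸ c) ⟧) (λ c → both c + both c) (suc n) ⟨
  ∑[ c < suc n ] (⟦ A c xor A (n ∸ c) ⟧ + (both c + both c))
    ≡⟨ ∑-cong (suc n) (λ c _ → ⟦⟧-xor-∧ (A c) (A (n ∸ c))) ⟩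
  ∑[ c < suc n ] (⟦ A c ⟧ + ⟦ A (n ∸ c) ⟧)
    ≡⟨ ∑-+ (λ c → ⟦ A c ⟧) (λ c → ⟦ A (n ∸ c) ⟧) (suc n) ⟩
  count A n + ∑[ c < suc n ] ⟦ A (n ∸ c) ⟧
    ≡⟨ cong (count A n +_) (∑-reverse (λ c → ⟦ A c ⟧) n) ⟩
  count A n + count A n
    ≡⟨ 2*n≡n+n (count A n) ⟨
  2 * count A n ∎
  where
  open ≡-Reasoning
  both : ℕ → ℕ
  both c = ⟦ A c ∧ A (n ∸ c) ⟧

cross : Subset → ℕ → ℕ → ℕ
cross A n c = ⟦ A (2 * c) ∧ A (1 + 2 * (n ∸ c)) ⟧ + ⟦ A (1 + 2 * c) ∧ A (2 * (n ∸ c)) ⟧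

orderedR₂-1+2* : ∀ A n → orderedR₂ A (1 + 2 * n) ≡ ∑[ c < suc n ] cross A n c
orderedR₂-1+2* A n = begin
  orderedR₂ A (1 + 2 * n)                ≡⟨ cong (λ k → ∑< k f) (*-suc 2 n) ⟨
  ∑< (2 * suc n) f                       ≡⟨ ∑-pairs f (suc n) ⟩
  ∑[ c < suc n ] (f (2 * c) + f (1 + 2 * c))   ≡⟨ ∑-cong (suc n) complements ⟩
  ∑[ c < suc n ] cross A n c             ∎
  where
  open ≡-Reasoning
  f : ℕ → ℕ
  f a = ⟦ A a ∧ A ((1 + 2 * n) ∸ a) ⟧
  complements : ∀ c → c < suc n → f (2 * c) + f (1 + 2 * c) ≡ cross A n c
  complements c c≤n = cong₂ (λ u v → ⟦ A (2 * c) ∧ A u ⟧ + ⟦ A (1 + 2 * c) ∧ A v ⟧)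
    (trans (+-∸-assoc 1 (*-monoʳ-≤ 2 (≤-pred c≤n))) (cong (1 +_) (sym (*-distribˡ-∸ 2 n c))))
    (sym (*-distribˡ-∸ 2 n c))

orderedR₂-doubling : ∀ A n (E F : ℕ → ℕ) →
  (∀ c → c < suc n → cross A n c + E c ≡ ⟦ A c xor A (n ∸ c) ⟧ + F c) →
  orderedR₂ A (1 + 2 * n) + ∑< (suc n) E + 2 * orderedR₂ A n ≡ 2 * count A n + ∑< (suc n) F
orderedR₂-doubling A n E F cross≈mixed = begin
  orderedR₂ A (1 + 2 * n) + ∑< (suc n) E + 2 * orderedR₂ A n
    ≡⟨ cong (λ r → r + ∑< (suc n) E + 2 * orderedR₂ A n) (orderedR₂-1+2* A n) ⟩
  ∑< (suc n) (cross A n) + ∑< (suc n) E + 2 * orderedR₂ A n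
    ≡⟨ cong (_+ 2 * orderedR₂ A n) (∑-+ (cross A n) E (suc n)) ⟨
  ∑[ c < suc n ] (cross A n c + E c) + 2 * orderedR₂ A n
    ≡⟨ cong (_+ 2 * orderedR₂ A n) (∑-cong (suc n) cross≈mixed) ⟩
  ∑[ c < suc n ] (⟦ A c xor A (n ∸ c) ⟧ + F c) + 2 * orderedR₂ A n
    ≡⟨ cong (_+ 2 * orderedR₂ A n) (∑-+ (λ c → ⟦ A c xor A (n ∸ c) ⟧) F (suc n)) ⟩
  mixed A n + ∑< (suc n) F + 2 * orderedR₂ A n
    ≡⟨ +-+-swap (mixed A n) (∑< (suc n) F) _ ⟩
  mixed A n + 2 * orderedR₂ A n + ∑< (suc n) F
    ≡⟨ cong (_+ ∑< (suc n) F) (mixed+orderedR₂ A n) ⟩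
  2 * count A n + ∑< (suc n) F ∎
  where
  open ≡-Reasoning
  +-+-swap : ∀ a b c → a + b + c ≡ a + c + b
  +-+-swap = solve-∀

-- The set χ

module _ (k : ℕ) where

  L : ℕ
  L = 2 ^ k

  1≤L : 1 ≤ L
  1≤L = m^n>0 2 k

  L≢0 : L ≢ 0
  L≢0 L≡0 = <-irrefl (sym L≡0) 1≤L

  2≤2*L : 2 ≤ 2 * L
  2≤2*L = *-monoʳ-≤ 2 1≤L

  χ-step : ℕ → Bool → Bool
  χ-step a χ[a/2] =
    if a <ᵇ 2 then false
    else if a ≡ᵇ 2 * L then true
    else if a % 2 ≡ᵇ 0 then χ[a/2] else not χ[a/2]

  χ-fuel : ℕ → ℕ → Bool
  χ-fuel zero    a = false
  χ-fuel (suc f) a = χ-step a (χ-fuel f (a / 2))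

  χ : Subset
  χ a = χ-fuel (suc a) a

  χ-fuel-enough : ∀ f g a → a < f → a < g → χ-fuel f a ≡ χ-fuel g a
  χ-fuel-enough (suc f) (suc g) zero       _ _ = refl
  χ-fuel-enough (suc f) (suc g) (suc zero) _ _ = refl
  χ-fuel-enough (suc f) (suc g) a@(suc (suc _)) (s≤s a≤f) (s≤s a≤g) =
    cong (χ-step a) (χ-fuel-enough f g (a / 2) (<-≤-trans a/2<a a≤f) (<-≤-trans a/2<a a≤g))
    where
    a/2<a : a / 2 < a
    a/2<a = n/2<n a (s≤s (s≤s z≤n))

  χ-unfold : ∀ a → χ a ≡ χ-step a (χ (a / 2))
  χ-unfold zero       = refl
  χ-unfold (suc zero) = refl
  χ-unfold a@(suc (suc _)) =
    cong (χ-step a) (χ-fuel-enough a (suc (a / 2)) (a / 2) (n/2<n a (s≤s (s≤s z≤n))) ≤-refl)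

  χ-step-generic : ∀ a b → 2 ≤ a → a ≢ 2 * L → χ-step a b ≡ (if a % 2 ≡ᵇ 0 then b else not b)
  χ-step-generic a b 2≤a a≢2L rewrite ≮⇒<ᵇ-false (≤⇒≯ 2≤a) | ≢⇒≡ᵇ-false a≢2L = refl

  χ-2L : χ (2 * L) ≡ true
  χ-2L rewrite χ-unfold (2 * L) | ≮⇒<ᵇ-false (≤⇒≯ 2≤2*L) | ≡ᵇ-refl (2 * L) = refl

  χ-double : ∀ c → c ≢ L → χ (2 * c) ≡ χ c
  χ-double zero       _   = refl
  χ-double c@(suc _) c≢L = begin
    χ (2 * c)                                  ≡⟨ χ-unfold (2 * c) ⟩
    χ-step (2 * c) (χ ((2 * c) / 2))
      ≡⟨ χ-step-generic (2 * c) _ (n≢0⇒2≤2*n {c} λ ()) (c≢L ∘ *-cancelˡ-≡ c L 2) ⟩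
    (if (2 * c) % 2 ≡ᵇ 0 then χ ((2 * c) / 2) else not (χ ((2 * c) / 2)))
      ≡⟨ cong₂ (λ r b → if r ≡ᵇ 0 then b else not b) ([2*n]%2≡0 c) (cong χ ([2*n]/2≡n c)) ⟩
    χ c                                        ∎
    where open ≡-Reasoning

  χ-1+double : ∀ c → c ≢ 0 → χ (1 + 2 * c) ≡ not (χ c)
  χ-1+double c c≢0 = begin
    χ (1 + 2 * c)                              ≡⟨ χ-unfold (1 + 2 * c) ⟩
    χ-step (1 + 2 * c) (χ ((1 + 2 * c) / 2))
      ≡⟨ χ-step-generic (1 + 2 * c) _ (≤-trans (n≢0⇒2≤2*n c≢0) (n≤1+n _)) (1+2*m≢2*n c L) ⟩
    (if (1 + 2 * c) % 2 ≡ᵇ 0 then χ ((1 + 2 * c) / 2) else not (χ ((1 + 2 * c) / 2)))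
      ≡⟨ cong₂ (λ r b → if r ≡ᵇ 0 then b else not b) ([1+2*n]%2≡1 c) (cong χ ([1+2*n]/2≡n c)) ⟩
    not (χ c)                                  ∎
    where open ≡-Reasoning

  χ-2^ : ∀ i → i ≤ k → χ (2 ^ i) ≡ false
  χ-2^ zero    _   = refl
  χ-2^ (suc i) i<k =
    trans (χ-double (2 ^ i) (<⇒≢ (^-monoʳ-< 2 (s≤s (s≤s z≤n)) i<k))) (χ-2^ i (<⇒≤ i<k))

  χ-L : χ L ≡ false
  χ-L = χ-2^ k ≤-refl

  χ-1+2L : χ (1 + 2 * L) ≡ true
  χ-1+2L = trans (χ-1+double L L≢0) (cong not χ-L)

  pair-count : ∀ c → ⟦ χ (2 * c) ⟧ + ⟦ χ (1 + 2 * c) ⟧ + δ 0 1 c ≡ 1 + δ L 1 c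
  pair-count c with c ≟ 0 | c ≟ L
  ... | yes refl | yes 0≡L = ⊥-elim (L≢0 (sym 0≡L))
  ... | yes refl | no _    = cong (1 +_) (sym (δ-off 1 (L≢0 ∘ sym)))
  ... | no c≢0   | yes refl rewrite χ-2L | χ-1+2L | δ-off 1 c≢0 | δ-at L 1 = refl
  ... | no c≢0   | no c≢L   rewrite χ-double c c≢L | χ-1+double c c≢0 | δ-off 1 c≢0 | δ-off 1 c≢L =
    trans (+-identityʳ _) (trans (+-comm ⟦ χ c ⟧ _) (⟦not⟧+⟦⟧ (χ c)))

  count-χ-odd : ∀ m → count χ (1 + 2 * m) + 1 ≡ suc m + ∑< (suc m) (δ L 1)
  count-χ-odd m = begin
    count χ (1 + 2 * m) + 1
      ≡⟨ cong₂ _+_ (trans (cong (λ j → ∑< j (λ a → ⟦ χ a ⟧)) (sym (*-suc 2 m)))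
                          (∑-pairs (λ a → ⟦ χ a ⟧) (suc m)))
                   (sym (∑-δ 0 1 (suc m) (s≤s z≤n))) ⟩
    ∑[ c < suc m ] (⟦ χ (2 * c) ⟧ + ⟦ χ (1 + 2 * c) ⟧) + ∑< (suc m) (δ 0 1)
      ≡⟨ ∑-+ (λ c → ⟦ χ (2 * c) ⟧ + ⟦ χ (1 + 2 * c) ⟧) (δ 0 1) (suc m) ⟨
    ∑[ c < suc m ] (⟦ χ (2 * c) ⟧ + ⟦ χ (1 + 2 * c) ⟧ + δ 0 1 c)
      ≡⟨ ∑-cong (suc m) (λ c _ → pair-count c) ⟩
    ∑[ c < suc m ] (1 + δ L 1 c)
      ≡⟨ ∑-+ (const 1) (δ L 1) (suc m) ⟩
    ∑[ c < suc m ] 1 + ∑< (suc m) (δ L 1)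
      ≡⟨ cong (_+ ∑< (suc m) (δ L 1)) (trans (∑-const (suc m) 1) (*-identityʳ (suc m))) ⟩
    suc m + ∑< (suc m) (δ L 1) ∎
    where open ≡-Reasoning

  count-χ-odd-below : ∀ m → m < L → count χ (1 + 2 * m) ≡ m
  count-χ-odd-below m m<L = +-cancelʳ-≡ 1 _ _ (trans (count-χ-odd m)
    (trans (cong (suc m +_) (∑-zero (δ L 1) (suc m) (λ c c≤m → δ-off 1 (<⇒≢ (≤-<-trans (≤-pred c≤m) m<L)))))
           (trans (+-identityʳ (suc m)) (+-comm 1 m))))

  count-χ-odd-above : ∀ m → L ≤ m → count χ (1 + 2 * m) ≡ suc m
  count-χ-odd-above m L≤m = +-cancelʳ-≡ 1 _ _ (trans (count-χ-odd m)
    (cong (suc m +_) (∑-δ L 1 (suc m) (s≤s L≤m))))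

  count-χ-even-above : ∀ m → L < m → count χ (2 * m) ≡ m + ⟦ χ m ⟧
  count-χ-even-above m L<m = +-cancelˡ-≡ ⟦ χ (1 + 2 * m) ⟧ _ _ (begin
    ⟦ χ (1 + 2 * m) ⟧ + count χ (2 * m)   ≡⟨ count-χ-odd-above m (<⇒≤ L<m) ⟩
    suc m                                  ≡⟨ +-comm 1 m ⟩
    m + 1                                  ≡⟨ cong (m +_) (⟦not⟧+⟦⟧ (χ m)) ⟨
    m + (⟦ not (χ m) ⟧ + ⟦ χ m ⟧)          ≡⟨ +-comm-middle m ⟦ not (χ m) ⟧ ⟦ χ m ⟧ ⟩
    ⟦ not (χ m) ⟧ + (m + ⟦ χ m ⟧)          ≡⟨ cong (λ b → ⟦ b ⟧ + (m + ⟦ χ m ⟧)) (χ-1+double m m≢0) ⟨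
    ⟦ χ (1 + 2 * m) ⟧ + (m + ⟦ χ m ⟧)      ∎)
    where
    open ≡-Reasoning
    m≢0 : m ≢ 0
    m≢0 m≡0 = n≮0 (subst (L <_) m≡0 L<m)
    +-comm-middle : ∀ a b c → a + (b + c) ≡ b + (a + c)
    +-comm-middle = solve-∀

  χ-R₂-compl : ∀ n → 2 * L < n → R₂ χ n ≡ R₂ (compl χ) n
  χ-R₂-compl n 2L<n with even-or-odd n
  ... | m , inj₁ refl = R₂-compl-even χ m (count-χ-even-above m (*-cancelˡ-< 2 L m 2L<n))
  ... | m , inj₂ refl = R₂-compl-odd χ m (count-χ-odd-above m (*-cancelˡ-≤ 2 (≤-pred 2L<n)))

  χ-doubled : ∀ j y → L < y → χ (doubled j y) ≡ χ y
  χ-doubled zero    y L<y = refl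
  χ-doubled (suc j) y L<y =
    trans (χ-double (doubled j y) (<⇒≢ (<-≤-trans L<y (y≤doubled j y)) ∘ sym)) (χ-doubled j y L<y)

  χ-∩-A₀-infinite : Infinite (λ a → χ a ≡ true × inA₀ a)
  χ-∩-A₀-infinite = infinite-via (λ j → doubled j y) (λ j → <⇒≤ (j<doubled j y (s≤s z≤n)))
    (λ j → trans (χ-doubled j y (s≤s (m≤m+n L _))) χ-1+2L ,
           cong (_% 2) (trans (D-doubled j y) (trans (D-1+double L L≢0) (cong suc (D-2^ k)))))
    where
    y : ℕ
    y = 1 + 2 * L

  χ-∩-B₀-infinite : Infinite (λ a → χ a ≡ true × inB₀ a)
  χ-∩-B₀-infinite = infinite-via (λ j → doubled j y) (λ j → <⇒≤ (j<doubled j y (≤-trans (s≤s z≤n) 2≤2*L)))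
    (λ j → trans (χ-doubled j y L<2L) χ-2L ,
           cong (_% 2) (trans (D-doubled j y) (trans (D-double L) (D-2^ k))))
    where
    y : ℕ
    y = 2 * L
    L<2L : L < 2 * L
    L<2L = subst (L <_) (sym (2*n≡n+n L)) (m<m+n L 1≤L)

  -- Representations of 2 ^ i − 1

  cross-generic : ∀ n c → c ≢ 0 → c ≢ L → n ∸ c ≢ 0 → n ∸ c ≢ L → cross χ n c ≡ ⟦ χ c xor χ (n ∸ c) ⟧
  cross-generic n c c≢0 c≢L d≢0 d≢L
    rewrite χ-double c c≢L | χ-1+double c c≢0 | χ-double (n ∸ c) d≢L | χ-1+double (n ∸ c) d≢0 =
    ⟦⟧-exactly-one (χ c) (χ (n ∸ c))

  cross-at-n : ∀ n → cross χ n n ≡ 0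
  cross-at-n n rewrite n∸n≡0 n | ∧-zeroʳ (χ (2 * n)) | ∧-zeroʳ (χ (1 + 2 * n)) = refl

  mixed-at-n : ∀ n → ⟦ χ n xor χ (n ∸ n) ⟧ ≡ ⟦ χ n ⟧
  mixed-at-n n rewrite n∸n≡0 n = cong ⟦_⟧ (xor-identityʳ (χ n))

  orderedR₂-χ-doubling-below : ∀ n → 1 ≤ n → n < L →
    orderedR₂ χ (1 + 2 * n) + 2 * ⟦ χ n ⟧ + 2 * orderedR₂ χ n ≡ 2 * count χ n
  orderedR₂-χ-doubling-below n 1≤n n<L = begin
    orderedR₂ χ (1 + 2 * n) + 2 * X + 2 * orderedR₂ χ n
      ≡⟨ cong (λ e → orderedR₂ χ (1 + 2 * n) + e + 2 * orderedR₂ χ n) (sym ∑E) ⟩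
    orderedR₂ χ (1 + 2 * n) + ∑< (suc n) E + 2 * orderedR₂ χ n
      ≡⟨ orderedR₂-doubling χ n E (const 0) pointwise ⟩
    2 * count χ n + ∑[ _ < suc n ] 0
      ≡⟨ cong (2 * count χ n +_) (∑-zero (const 0) (suc n) (λ _ _ → refl)) ⟩
    2 * count χ n + 0
      ≡⟨ +-identityʳ _ ⟩
    2 * count χ n ∎
    where
    open ≡-Reasoning
    X : ℕ
    X = ⟦ χ n ⟧
    E : ℕ → ℕ
    E c = δ 0 X c + δ n X c
    n≢0 : n ≢ 0
    n≢0 = <⇒≢ 1≤n ∘ sym
    ∑E : ∑< (suc n) E ≡ 2 * X
    ∑E = trans (∑-+ (δ 0 X) (δ n X) (suc n))
               (trans (cong₂ _+_ (∑-δ 0 X (suc n) (s≤s z≤n)) (∑-δ n X (suc n) ≤-refl)) (sym (2*n≡n+n X)))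
    pointwise : ∀ c → c < suc n → cross χ n c + E c ≡ ⟦ χ c xor χ (n ∸ c) ⟧ + 0
    pointwise c c≤n with c ≟ 0 | c ≟ n
    ... | yes refl | _        = cong (X +_) (δ-off X (n≢0 ∘ sym))
    ... | no c≢0   | yes refl = begin
      cross χ n n + E n        ≡⟨ cong₂ _+_ (cross-at-n n) (cong₂ _+_ (δ-off X n≢0) (δ-at n X)) ⟩
      X                        ≡⟨ mixed-at-n n ⟨
      ⟦ χ n xor χ (n ∸ n) ⟧    ≡⟨ +-identityʳ _ ⟨
      ⟦ χ n xor χ (n ∸ n) ⟧ + 0 ∎
    ... | no c≢0   | no c≢n   = cong₂ _+_
      (cross-generic n c c≢0 (<⇒≢ (≤-<-trans (≤-pred c≤n) n<L))
        (c≢n ∘ ≤-antisym (≤-pred c≤n) ∘ m∸n≡0⇒m≤n) (<⇒≢ (≤-<-trans (m∸n≤m n c) n<L)))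
      (cong₂ _+_ (δ-off X c≢0) (δ-off X c≢n))

  module _ (n : ℕ) (L<n : L < n) (n≢2L : n ≢ 2 * L) where

    private
      m : ℕ
      m = n ∸ L
      L+m≡n : L + m ≡ n
      L+m≡n = m+[n∸m]≡n (<⇒≤ L<n)
      m≢0 : m ≢ 0
      m≢0 m≡0 = <⇒≢ L<n (trans (sym (+-identityʳ L)) (trans (cong (L +_) (sym m≡0)) L+m≡n))
      L≢m : L ≢ m
      L≢m L≡m = n≢2L (trans (sym L+m≡n) (trans (cong (L +_) (sym L≡m)) (sym (2*n≡n+n L))))
      m<n : m < n
      m<n = subst (m <_) (trans (+-comm m L) L+m≡n) (m<m+n m 1≤L)
      n∸m≡L : n ∸ m ≡ L
      n∸m≡L = m∸[m∸n]≡n (<⇒≤ L<n)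

    cross-at-L : cross χ n L ≡ 1
    cross-at-L rewrite χ-2L | χ-1+2L | χ-1+double m m≢0 | χ-double m (L≢m ∘ sym) = ⟦not⟧+⟦⟧ (χ m)

    cross-at-n∸L : cross χ n m ≡ 1
    cross-at-n∸L rewrite n∸m≡L | χ-2L | χ-1+2L | ∧-identityʳ (χ (2 * m)) | ∧-identityʳ (χ (1 + 2 * m))
                       | χ-1+double m m≢0 | χ-double m (L≢m ∘ sym) = trans (+-comm ⟦ χ m ⟧ _) (⟦not⟧+⟦⟧ (χ m))

    mixed-at-L : ⟦ χ L xor χ (n ∸ L) ⟧ ≡ ⟦ χ m ⟧
    mixed-at-L rewrite χ-L = refl

    mixed-at-n∸L : ⟦ χ m xor χ (n ∸ m) ⟧ ≡ ⟦ χ m ⟧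
    mixed-at-n∸L rewrite n∸m≡L | χ-L = cong ⟦_⟧ (xor-identityʳ (χ m))

    private
      X Y : ℕ
      X = ⟦ χ n ⟧
      Y = ⟦ χ m ⟧
      n≢0 : n ≢ 0
      n≢0 = <⇒≢ (≤-<-trans z≤n L<n) ∘ sym
      L≤n : L < suc n
      m≤n : m < suc n
      L≤n = s≤s (<⇒≤ L<n)
      m≤n = s≤s (<⇒≤ m<n)

      -- cross χ n and the summand of mixed χ n differ only at 0, n, L and m = n ∸ L;
      -- E and F record the difference.
      E F : ℕ → ℕ
      E c = δ 0 X c + δ n X c + (δ L Y c + δ m Y c)
      F c = δ L 1 c + δ m 1 c

      ∑E : ∑< (suc n) E ≡ 2 * (X + Y)
      ∑E = begin
        ∑< (suc n) E
          ≡⟨ ∑-+ (λ c → δ 0 X c + δ n X c) (λ c → δ L Y c + δ m Y c) (suc n) ⟩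
        ∑< (suc n) (λ c → δ 0 X c + δ n X c) + ∑< (suc n) (λ c → δ L Y c + δ m Y c)
          ≡⟨ cong₂ _+_ (∑-+ (δ 0 X) (δ n X) (suc n)) (∑-+ (δ L Y) (δ m Y) (suc n)) ⟩
        ∑< (suc n) (δ 0 X) + ∑< (suc n) (δ n X) + (∑< (suc n) (δ L Y) + ∑< (suc n) (δ m Y))
          ≡⟨ cong₂ _+_ (cong₂ _+_ (∑-δ 0 X (suc n) (s≤s z≤n)) (∑-δ n X (suc n) ≤-refl))
                       (cong₂ _+_ (∑-δ L Y (suc n) L≤n) (∑-δ m Y (suc n) m≤n)) ⟩
        X + X + (Y + Y)
          ≡⟨ regroup X Y ⟩
        2 * (X + Y) ∎
        where
        open ≡-Reasoning
        regroup : ∀ x y → x + x + (y + y) ≡ 2 * (x + y)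
        regroup = solve-∀

      ∑F : ∑< (suc n) F ≡ 2
      ∑F = trans (∑-+ (δ L 1) (δ m 1) (suc n)) (cong₂ _+_ (∑-δ L 1 (suc n) L≤n) (∑-δ m 1 (suc n) m≤n))

      Balanced : ℕ → Set
      Balanced c = cross χ n c + E c ≡ ⟦ χ c xor χ (n ∸ c) ⟧ + F c

      balanced-at-0 : Balanced 0
      balanced-at-0 = begin
        0 + E 0               ≡⟨ cong₂ (λ u v → X + u + v) (δ-off X (n≢0 ∘ sym))
                                         (cong₂ _+_ (δ-off Y (L≢0 ∘ sym)) (δ-off Y (m≢0 ∘ sym))) ⟩
        X + 0 + 0             ≡⟨ cong (_+ 0) (+-identityʳ X) ⟩
        X + 0                 ≡⟨ cong (X +_) (cong₂ _+_ (δ-off 1 (L≢0 ∘ sym)) (δ-off 1 (m≢0 ∘ sym))) ⟨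
        X + F 0               ∎
        where open ≡-Reasoning

      balanced-at-n : Balanced n
      balanced-at-n = begin
        cross χ n n + E n     ≡⟨ cong₂ _+_ (cross-at-n n) (cong₂ _+_ (cong₂ _+_ (δ-off X n≢0) (δ-at n X))
                                                                   (cong₂ _+_ (δ-off Y (<⇒≢ L<n ∘ sym)) (δ-off Y (<⇒≢ m<n ∘ sym)))) ⟩
        X + 0                 ≡⟨ cong₂ _+_ (mixed-at-n n)
                                           (cong₂ _+_ (δ-off 1 (<⇒≢ L<n ∘ sym)) (δ-off 1 (<⇒≢ m<n ∘ sym))) ⟨
        ⟦ χ n xor χ (n ∸ n) ⟧ + F n ∎
        where open ≡-Reasoning

      balanced-at-L : Balanced L
      balanced-at-L = begin
        cross χ n L + E L     ≡⟨ cong₂ _+_ cross-at-L (cong₂ _+_ (cong₂ _+_ (δ-off X L≢0) (δ-off X (<⇒≢ L<n)))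
                                                                (cong₂ _+_ (δ-at L Y) (δ-off Y L≢m))) ⟩
        1 + (Y + 0)           ≡⟨ +-comm 1 (Y + 0) ⟩
        Y + 0 + 1             ≡⟨ cong (_+ 1) (+-identityʳ Y) ⟩
        Y + 1                 ≡⟨ cong₂ _+_ mixed-at-L (cong₂ _+_ (δ-at L 1) (δ-off 1 L≢m)) ⟨
        ⟦ χ L xor χ (n ∸ L) ⟧ + F L ∎
        where open ≡-Reasoning

      balanced-at-m : Balanced m
      balanced-at-m = begin
        cross χ n m + E m     ≡⟨ cong₂ _+_ cross-at-n∸L (cong₂ _+_ (cong₂ _+_ (δ-off X m≢0) (δ-off X (<⇒≢ m<n)))
                                                                  (cong₂ _+_ (δ-off Y (L≢m ∘ sym)) (δ-at m Y))) ⟩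
        1 + Y                 ≡⟨ +-comm 1 Y ⟩
        Y + 1                 ≡⟨ cong₂ _+_ mixed-at-n∸L (cong₂ _+_ (δ-off 1 (L≢m ∘ sym)) (δ-at m 1)) ⟨
        ⟦ χ m xor χ (n ∸ m) ⟧ + F m ∎
        where open ≡-Reasoning

      balanced : ∀ c → c < suc n → Balanced c
      balanced c c≤n with c ≟ 0 | c ≟ n | c ≟ L | c ≟ m
      ... | yes refl | _       | _        | _       = balanced-at-0
      ... | no _     | yes c≡n | _        | _       = subst Balanced (sym c≡n) balanced-at-n
      ... | no _     | no _    | yes refl | _       = balanced-at-L
      ... | no _     | no _    | no _     | yes c≡m = subst Balanced (sym c≡m) balanced-at-m
      ... | no c≢0   | no c≢n  | no c≢L   | no c≢m  = cong₂ _+_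
        (cross-generic n c c≢0 c≢L (c≢n ∘ ≤-antisym (≤-pred c≤n) ∘ m∸n≡0⇒m≤n)
                       (c≢m ∘ λ n∸c≡L → trans (sym (m∸[m∸n]≡n (≤-pred c≤n))) (cong (n ∸_) n∸c≡L)))
        (trans (cong₂ _+_ (cong₂ _+_ (δ-off X c≢0) (δ-off X c≢n)) (cong₂ _+_ (δ-off Y c≢L) (δ-off Y c≢m)))
               (sym (cong₂ _+_ (δ-off 1 c≢L) (δ-off 1 c≢m))))

    orderedR₂-χ-doubling-above :
      orderedR₂ χ (1 + 2 * n) + 2 * (⟦ χ n ⟧ + ⟦ χ (n ∸ L) ⟧) + 2 * orderedR₂ χ n ≡ 2 * count χ n + 2
    orderedR₂-χ-doubling-above = begin
      orderedR₂ χ (1 + 2 * n) + 2 * (X + Y) + 2 * orderedR₂ χ n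
        ≡⟨ cong (λ e → orderedR₂ χ (1 + 2 * n) + e + 2 * orderedR₂ χ n) (sym ∑E) ⟩
      orderedR₂ χ (1 + 2 * n) + ∑< (suc n) E + 2 * orderedR₂ χ n
        ≡⟨ orderedR₂-doubling χ n E F balanced ⟩
      2 * count χ n + ∑< (suc n) F
        ≡⟨ cong (2 * count χ n +_) ∑F ⟩
      2 * count χ n + 2 ∎
      where open ≡-Reasoning

  χ-appendOnes : ∀ s c → c ≢ 0 → χ (appendOnes s c) ≡ odd s xor χ c
  χ-appendOnes zero    c c≢0 = refl
  χ-appendOnes (suc s) c c≢0 =
    trans (χ-1+double (appendOnes s c) (appendOnes-≢0 s c c≢0))
          (trans (cong not (χ-appendOnes s c c≢0)) (not-distribˡ-xor (odd s) (χ c)))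

  χ-ones : ∀ j → χ (ones (suc j)) ≡ odd j
  χ-ones zero    = refl
  χ-ones (suc j) = trans (χ-1+double (ones (suc j)) λ ()) (cong not (χ-ones j))

  ones<L : ∀ i → i ≤ k → ones i < L
  ones<L i i≤k = subst (_≤ L) (sym (suc-ones i)) (^-monoʳ-≤ 2 i≤k)

  q : ℕ → ℕ
  q i = orderedR₂ χ (ones i)

  q-step-below : ∀ j → suc j ≤ k → q (2 + j) + 2 * ⟦ odd j ⟧ + 2 * q (1 + j) ≡ 2 * ones j
  q-step-below j 1+j≤k = begin
    q (2 + j) + 2 * ⟦ odd j ⟧ + 2 * q (1 + j)
      ≡⟨ cong (λ b → q (2 + j) + 2 * ⟦ b ⟧ + 2 * q (1 + j)) (χ-ones j) ⟨
    q (2 + j) + 2 * ⟦ χ (ones (suc j)) ⟧ + 2 * q (1 + j)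
      ≡⟨ orderedR₂-χ-doubling-below (ones (suc j)) (s≤s z≤n) (ones<L (suc j) 1+j≤k) ⟩
    2 * count χ (ones (suc j))
      ≡⟨ cong (2 *_) (count-χ-odd-below (ones j) (ones<L j (<⇒≤ 1+j≤k))) ⟩
    2 * ones j ∎
    where open ≡-Reasoning

  q-odd-below  : ∀ r → twice r ≤ k → q (1 + twice r) ≡ 0
  q-even-below : ∀ r → 1 + twice r ≤ k → q (2 + twice r) ≡ 2 * ones (twice r)

  q-odd-below zero    _      = refl
  q-odd-below (suc r) 2+2r≤k = cancel (q (3 + twice r)) (ones (twice r))
    (trans (cong₂ (λ b y → q (3 + twice r) + 2 * ⟦ not b ⟧ + 2 * y)
                  (sym (odd-twice r)) (sym (q-even-below r (≤-trans (n≤1+n _) 2+2r≤k))))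
           (q-step-below (1 + twice r) 2+2r≤k))
    where
    cancel : ∀ x o → x + 2 + 2 * (2 * o) ≡ 2 * (1 + 2 * o) → x ≡ 0
    cancel x o eq = +-cancelʳ-≡ (2 + 2 * (2 * o)) x 0 (trans (reassoc x o) (trans eq (arith o)))
      where
      reassoc : ∀ x o → x + (2 + 2 * (2 * o)) ≡ x + 2 + 2 * (2 * o)
      reassoc = solve-∀
      arith : ∀ o → 2 * (1 + 2 * o) ≡ 2 + 2 * (2 * o)
      arith = solve-∀

  q-even-below r 1+2r≤k = trans (sym (trans (+-identityʳ _) (+-identityʳ _)))
    (trans (cong₂ (λ b y → q (2 + twice r) + 2 * ⟦ b ⟧ + 2 * y)
                  (sym (odd-twice r)) (sym (q-odd-below r (<⇒≤ 1+2r≤k))))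
           (q-step-below (twice r) 1+2r≤k))

  q-step-above : ∀ i → L < ones (suc i) → ⟦ χ (ones (suc i)) ⟧ + ⟦ χ (ones (suc i) ∸ L) ⟧ ≡ 1 →
    q (2 + i) + 2 * q (1 + i) ≡ 2 * count χ (ones (suc i))
  q-step-above i L<n X+Y≡1 = cancel (q (2 + i)) (2 * q (1 + i)) _ (begin
    q (2 + i) + 2 + 2 * q (1 + i)
      ≡⟨ cong (λ s → q (2 + i) + 2 * s + 2 * q (1 + i)) X+Y≡1 ⟨
    q (2 + i) + 2 * (⟦ χ (ones (suc i)) ⟧ + ⟦ χ (ones (suc i) ∸ L) ⟧) + 2 * q (1 + i)
      ≡⟨ orderedR₂-χ-doubling-above (ones (suc i)) L<n (1+2*m≢2*n (ones i) L) ⟩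
    2 * count χ (ones (suc i)) + 2 ∎)
    where
    open ≡-Reasoning
    cancel : ∀ a b c → a + 2 + b ≡ c + 2 → a + b ≡ c
    cancel a b c eq = +-cancelʳ-≡ 2 _ _ (trans (swap a b) eq)
      where
      swap : ∀ a b → a + b + 2 ≡ a + 2 + b
      swap = solve-∀

  q-step-threshold : 1 ≤ k → q (2 + k) + 2 * q (1 + k) ≡ 2 * ones k
  q-step-threshold (s≤s {n = k′} z≤n) =
    trans (q-step-above k L<n χn+χ[n∸L]≡1) (cong (2 *_) (count-χ-odd-below o (ones<L k ≤-refl)))
    where
    o : ℕ
    o = ones k
    o+1≡L : suc o ≡ L
    o+1≡L = suc-ones k
    L<n : L < ones (suc k)
    L<n = subst (_< ones (suc k)) o+1≡L (s≤s (subst (suc o ≤_) (sym (2*n≡n+n o)) (+-monoˡ-≤ o (s≤s z≤n))))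
    n∸L≡o : ones (suc k) ∸ L ≡ o
    n∸L≡o = trans (cong (ones (suc k) ∸_) (sym o+1≡L)) (trans (cong (_∸ o) (2*n≡n+n o)) (m+n∸n≡m o o))
    χn+χ[n∸L]≡1 : ⟦ χ (ones (suc k)) ⟧ + ⟦ χ (ones (suc k) ∸ L) ⟧ ≡ 1
    χn+χ[n∸L]≡1 = trans (cong₂ (λ u v → ⟦ u ⟧ + ⟦ χ v ⟧) (χ-ones k) n∸L≡o)
                        (trans (cong (λ b → ⟦ not b ⟧ + ⟦ χ o ⟧) (sym (χ-ones k′))) (⟦not⟧+⟦⟧ (χ o)))

  ones-above-L : ∀ t → ones (k + suc t) ≡ appendOnes k (2 * ones t) + L
  ones-above-L t = trans (sym (appendOnes-ones k (suc t))) (appendOnes-suc k (2 * ones t))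

  Recurrence : ℕ → Set
  Recurrence i = q (suc i) + 2 * q i ≡ 2 ^ i

  recurrence-at : ∀ t → ones (suc t) ≢ L → Recurrence (suc (k + suc t))
  recurrence-at t ones≢L =
    trans (q-step-above i L<n χn+χ[n∸L]≡1) (cong (2 *_) (trans (count-χ-odd-above (ones i) L≤ones-i) (suc-ones i)))
    where
    i : ℕ
    i = k + suc t
    W : ℕ
    W = appendOnes k (2 * ones (suc t))
    n≡W+L : ones (suc i) ≡ W + L
    n≡W+L = trans (cong ones (sym (+-suc k (suc t)))) (ones-above-L (suc t))
    L≤ones-i : L ≤ ones i
    L≤ones-i = subst (L ≤_) (sym (ones-above-L t)) (m≤n+m L _)
    L<n : L < ones (suc i)
    L<n = ≤-<-trans L≤ones-i (s≤s (subst (ones i ≤_) (sym (2*n≡n+n (ones i))) (m≤m+n (ones i) _)))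
    n∸L≡W : ones (suc i) ∸ L ≡ W
    n∸L≡W = trans (cong (_∸ L) n≡W+L) (m+n∸n≡m W L)
    χn : χ (ones (suc i)) ≡ odd k xor not (odd t)
    χn = trans (cong χ (trans (cong ones (sym (+-suc k (suc t)))) (sym (appendOnes-ones k (suc (suc t))))))
               (trans (χ-appendOnes k (ones (suc (suc t))) λ ()) (cong (odd k xor_) (χ-ones (suc t))))
    χW : χ W ≡ odd k xor odd t
    χW = trans (χ-appendOnes k (2 * ones (suc t)) λ ())
               (cong (odd k xor_) (trans (χ-double (ones (suc t)) ones≢L) (χ-ones t)))
    χn+χ[n∸L]≡1 : ⟦ χ (ones (suc i)) ⟧ + ⟦ χ (ones (suc i) ∸ L) ⟧ ≡ 1
    χn+χ[n∸L]≡1 = begin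
      ⟦ χ (ones (suc i)) ⟧ + ⟦ χ (ones (suc i) ∸ L) ⟧
        ≡⟨ cong₂ (λ u v → ⟦ u ⟧ + ⟦ v ⟧) χn (trans (cong χ n∸L≡W) χW) ⟩
      ⟦ odd k xor not (odd t) ⟧ + ⟦ odd k xor odd t ⟧
        ≡⟨ cong (λ b → ⟦ b ⟧ + ⟦ odd k xor odd t ⟧) (not-distribʳ-xor (odd k) (odd t)) ⟨
      ⟦ not (odd k xor odd t) ⟧ + ⟦ odd k xor odd t ⟧
        ≡⟨ ⟦not⟧+⟦⟧ (odd k xor odd t) ⟩
      1 ∎
      where open ≡-Reasoning

  q-quadruples : ∀ i → Recurrence i → Recurrence (suc i) → q (2 + i) ≡ 4 * q i
  q-quadruples i recurrence₀ recurrence₁ = +-cancelʳ-≡ (2 * q (1 + i)) _ _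
    (trans recurrence₁ (trans (cong (2 *_) (sym recurrence₀)) (arith (q (1 + i)) (q i))))
    where
    arith : ∀ a b → 2 * (a + 2 * b) ≡ 4 * b + 2 * a
    arith = solve-∀

  Small : ℕ → Set
  Small i = q i * (2 * L) ≤ 2 ^ i

  small-step : ∀ i → Recurrence i → Recurrence (suc i) → Small i → Small (2 + i)
  small-step i recurrence₀ recurrence₁ small = begin
    q (2 + i) * (2 * L)   ≡⟨ cong (_* (2 * L)) (q-quadruples i recurrence₀ recurrence₁) ⟩
    4 * q i * (2 * L)     ≡⟨ *-assoc 4 (q i) (2 * L) ⟩
    4 * (q i * (2 * L))   ≤⟨ *-monoʳ-≤ 4 small ⟩
    4 * 2 ^ i             ≡⟨ arith (2 ^ i) ⟩
    2 ^ (2 + i)           ∎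
    where
    open ≤-Reasoning
    arith : ∀ x → 4 * x ≡ 2 * (2 * x)
    arith = solve-∀

  small-iterate : ∀ i₀ → (∀ i → i₀ ≤ i → Recurrence i) → Small i₀ → ∀ r → Small (twice r + i₀)
  small-iterate i₀ recurrence small zero    = small
  small-iterate i₀ recurrence small (suc r) = small-step (twice r + i₀)
    (recurrence _ (m≤n+m i₀ (twice r)))
    (recurrence _ (≤-trans (m≤n+m i₀ (twice r)) (n≤1+n _)))
    (small-iterate i₀ recurrence small r)

  R₂-bound-from-small : ∀ i → Small (suc i) → R₂ χ (ones (suc i)) * (4 * L) ≤ ones (suc i) + 1
  R₂-bound-from-small i small = begin
    R₂ χ n * (4 * L)         ≡⟨ arith (R₂ χ n) L ⟩
    2 * R₂ χ n * (2 * L)     ≡⟨ cong (_* (2 * L)) (orderedR₂-odd χ (ones i)) ⟨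
    q (suc i) * (2 * L)      ≤⟨ small ⟩
    2 ^ suc i                ≡⟨ suc-ones (suc i) ⟨
    suc n                    ≡⟨ +-comm 1 n ⟩
    n + 1                    ∎
    where
    open ≤-Reasoning
    n : ℕ
    n = ones (suc i)
    arith : ∀ r x → r * (4 * x) ≡ 2 * r * (2 * x)
    arith = solve-∀

  R₂-small-infinitely-often : ∀ i₀ → (∀ i → suc i₀ ≤ i → Recurrence i) → Small (suc i₀) →
    Infinite (λ n → R₂ χ n * (4 * L) ≤ n + 1)
  R₂-small-infinitely-often i₀ recurrence small = infinite-via (λ r → ones (suc (twice r + i₀)))
    (λ r → ≤-trans (r≤twice r) (≤-trans (m≤m+n (twice r) i₀) (≤-trans (n≤1+n _) (i≤ones _))))
    (λ r → R₂-bound-from-small (twice r + i₀)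
             (subst Small (+-suc (twice r) i₀) (small-iterate (suc i₀) recurrence small r)))

  recurrence-from : 1 ≤ k → ∀ i → 2 + k ≤ i → Recurrence i
  recurrence-from (s≤s {n = k′} z≤n) i 2+k≤i =
    subst Recurrence i≡ (recurrence-at (i ∸ (2 + k)) (1+2*m≢2*n (ones (i ∸ (2 + k))) (2 ^ k′)))
    where
    i≡ : suc (k + suc (i ∸ (2 + k))) ≡ i
    i≡ = trans (cong suc (+-suc k _)) (m+[n∸m]≡n 2+k≤i)

  small-base-odd : ∀ r → k ≡ suc (twice r) → Small (2 + k)
  small-base-odd r refl = subst (λ x → x * (2 * L) ≤ 2 ^ (2 + k)) (sym q≡2) ≤-refl
    where
    o : ℕ
    o = ones (twice r)
    q≡2 : q (2 + k) ≡ 2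
    q≡2 = +-cancelʳ-≡ (2 * (2 * o)) _ 2
      (trans (cong (λ x → q (2 + k) + 2 * x) (sym (q-even-below r ≤-refl))) (trans (q-step-threshold (s≤s z≤n)) (arith o)))
      where
      arith : ∀ o → 2 * (1 + 2 * o) ≡ 2 + 2 * (2 * o)
      arith = solve-∀

  small-base-even : ∀ r → k ≡ twice (suc r) → Small (3 + k)
  small-base-even r refl = subst (λ x → x * (2 * L) ≤ 2 ^ (3 + k)) (sym q≡4) (≤-reflexive (arith L))
    where
    q[1+k]≡0 : q (1 + k) ≡ 0
    q[1+k]≡0 = q-odd-below (suc r) ≤-refl
    q[2+k] : q (2 + k) ≡ 2 * ones k
    q[2+k] = trans (sym (trans (cong (λ x → q (2 + k) + 2 * x) q[1+k]≡0) (+-identityʳ _))) (q-step-threshold (s≤s z≤n))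
    q≡4 : q (3 + k) ≡ 4
    q≡4 = +-cancelʳ-≡ (2 * (2 * ones k)) _ 4 (begin
      q (3 + k) + 2 * (2 * ones k)     ≡⟨ cong (λ x → q (3 + k) + 2 * x) q[2+k] ⟨
      q (3 + k) + 2 * q (2 + k)        ≡⟨ recurrence-from (s≤s z≤n) (2 + k) ≤-refl ⟩
      2 * (2 * L)                      ≡⟨ cong (λ x → 2 * (2 * x)) (suc-ones k) ⟨
      2 * (2 * suc (ones k))           ≡⟨ arith′ (ones k) ⟩
      4 + 2 * (2 * ones k)             ∎)
      where
      open ≡-Reasoning
      arith′ : ∀ o → 2 * (2 * suc o) ≡ 4 + 2 * (2 * o)
      arith′ = solve-∀
    arith : ∀ x → 4 * (2 * x) ≡ 2 * (2 * (2 * x))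
    arith = solve-∀

  χ-R₂-small-infinitely-often : Infinite (λ n → R₂ χ n * (4 * L) ≤ n + 1)
  χ-R₂-small-infinitely-often with zero-or-odd-or-even k
  ... | inj₁ refl = R₂-small-infinitely-often 2 recurrence-from-3 (m≤m+n 4 4)  -- q 3 * 2 evaluates to 4
    where
    recurrence-from-3 : ∀ i → 3 ≤ i → Recurrence i
    recurrence-from-3 (suc (suc (suc t))) _                 = recurrence-at (suc t) λ ()
    recurrence-from-3 (suc zero)          (s≤s ())
    recurrence-from-3 (suc (suc zero))    (s≤s (s≤s ()))
  ... | inj₂ (inj₁ (r , k≡1+2r)) = R₂-small-infinitely-often (suc k)
    (recurrence-from (subst (1 ≤_) (sym k≡1+2r) (s≤s z≤n))) (small-base-odd r k≡1+2r)
  ... | inj₂ (inj₂ (r , k≡2+2r)) = R₂-small-infinitely-often (2 + k)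
    (λ i 3+k≤i → recurrence-from (subst (1 ≤_) (sym k≡2+2r) (s≤s z≤n)) i (≤-trans (n≤1+n _) 3+k≤i))
    (small-base-even r k≡2+2r)

theorem1 : (N : ℕ) → N ≥ 2 →
    ∃[ A ] (((n : ℕ) → n ≥ 2 * N ∸ 1 → R₂ A n ≡ R₂ (compl A) n)
      × Infinite (λ a → A a ≡ true × inA₀ a)
      × Infinite (λ a → A a ≡ true × inB₀ a)
      × Infinite (λ n → R₂ A n * (4 * 2 ^ ⌊log₂ (N ∸ 1) ⌋) ≤ n + 1))
theorem1 N N≥2 =
  χ k , (λ n n≥2N-1 → χ-R₂-compl k n (<-≤-trans 2L<2N-1 n≥2N-1)) ,
  χ-∩-A₀-infinite k , χ-∩-B₀-infinite k , χ-R₂-small-infinitely-often k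
  where
  k : ℕ
  k = ⌊log₂ (N ∸ 1) ⌋
  L≤N-1 : L k ≤ N ∸ 1
  L≤N-1 = 2^⌊log₂n⌋≤n (N ∸ 1) (∸-monoˡ-≤ 1 N≥2)
  L<N : L k < N
  L<N = subst (suc (L k) ≤_) (m+[n∸m]≡n (≤-trans (s≤s z≤n) N≥2)) (s≤s L≤N-1)
  2L<2N-1 : 2 * L k < 2 * N ∸ 1
  2L<2N-1 = begin-strict
    2 * L k            <⟨ n<1+n _ ⟩
    suc (2 * L k)      ≡⟨ cong (_∸ 1) (*-suc 2 (L k)) ⟨
    2 * suc (L k) ∸ 1  ≤⟨ ∸-monoˡ-≤ 1 (*-monoʳ-≤ 2 L<N) ⟩
    2 * N ∸ 1          ∎
    where open ≤-Reasoning
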